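{- Let $S$ be a closed semi-Thue system over $\Sigma$. Cut elimination holds for $\mathrm{SKm}(S)$: every nested sequent derivable in $\mathrm{SKm}(S)$ is derivable in $\mathrm{SKm}(S)$ without the $\mathit{cut}$ rule.
   Context: $\Sigma$ is an alphabet with involution $a\mapsto\bar a$ ($\bar{\bar a}=a$); $\overline{a_1\cdots a_n}=\bar a_n\cdots\bar a_1$. A semi-Thue system $S$ is a set of rules $u\to v$ ($u,v\in\Sigma^*$), closed if $u\to v\in S$ implies $\bar u\to\bar v\in S$. Formulae are built from atoms $p$, negated atoms, $\lor,\land,[a],\langle a\rangle$ (negation normal form); $\sim\! A$ is the nnf of $\neg A$. A nested sequent is a finite multiset of formulae and structures $a\{\Delta\}$ ($\Delta$ a nested sequent); $u\{\Delta\}=a_1\{\cdots a_n\{\Delta\}\cdots\}$ for $u=a_1\cdots a_n$, $\epsilon\{\Delta\}=\Delta$. $\mathrm{SKm}(S)$ has rules (conclusion from premises): $\mathit{id}$: $\Gamma,p,\neg p$; $\mathit{cut}$: $\Gamma,\Delta$ from $\Gamma,A$ and $\Delta,\sim\! A$; $\mathit{ctr}$: $\Gamma,\Delta$ from $\Gamma,\Delta,\Delta$; $\mathit{wk}$: $\Gamma,\Delta$ from $\Gamma$; $r$: $\bar a\{\Gamma\},\Delta$ from $\Gamma,a\{\Delta\}$; $\land$: $\Gamma,A\land B$ from $\Gamma,A$ and $\Gamma,B$; $\lor$: $\Gamma,A\lor B$ from $\Gamma,A,B$; $[a]$: $\Gamma,[a]A$ from $\Gamma,a\{A\}$; $\langle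 a\rangle$: $\Gamma,a\{\Delta\},\langle a\rangle A$ from $\Gamma,a\{\Delta,A\}$; and for each $u\to v\in S$: $v\{\Delta\},\Gamma$ from $u\{\Delta\},\Gamma$. -}

module Defs where

open import Data.Nat using (ℕ)
open import Data.List using (List; []; _∷_; _++_; [_]; map; reverse)
open import Data.Bool using (Bool; true; false)
open import Data.Fin using (Fin)
open import Function.Bundles using (_↔_)
open import Relation.Binary.PropositionalEquality using (_≡_)

Atom : Set
Atom = ℕ

module Syntax (Σ : Set) (inv : Σ → Σ) where

  barW : List Σ → List Σ
  barW u = reverse (map inv u)

  -- formulae in negation normal form
  data Fm : Set where
    at   : Atom → Fm
    nat  : Atom → Fm
    _∨ᶠ_ : Fm → Fm → Fm
    _∧ᶠ_ : Fm → Fm → Fm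
    box  : Σ → Fm → Fm
    dia  : Σ → Fm → Fm

  ∼_ : Fm → Fm
  ∼ at p = nat p
  ∼ nat p = at p
  ∼ (A ∨ᶠ B) = (∼ A) ∧ᶠ (∼ B)
  ∼ (A ∧ᶠ B) = (∼ A) ∨ᶠ (∼ B)
  ∼ box a A = dia a (∼ A)
  ∼ dia a A = box a (∼ A)

  -- nested sequents: lists of items, considered up to nested permutation (_≈_)
  data Item : Set where
    fm   : Fm → Item
    nest : Σ → List Item → Item

  Seq : Set
  Seq = List Item

  wrap : List Σ → Seq → Seq
  wrap [] Δ = Δ
  wrap (a ∷ u) Δ = [ nest a (wrap u Δ) ]

  data _≈_ : Seq → Seq → Set where
    ≈-refl  : ∀ {Γ} → Γ ≈ Γ
    ≈-sym   : ∀ {Γ Δ} → Γ ≈ Δ → Δ ≈ Γ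
    ≈-trans : ∀ {Γ Δ Θ} → Γ ≈ Δ → Δ ≈ Θ → Γ ≈ Θ
    ≈-swap  : ∀ {x y Γ} → (x ∷ y ∷ Γ) ≈ (y ∷ x ∷ Γ)
    ≈-tail  : ∀ {x Γ Δ} → Γ ≈ Δ → (x ∷ Γ) ≈ (x ∷ Δ)
    ≈-nest  : ∀ {a Δ Δ' Γ} → Δ ≈ Δ' → (nest a Δ ∷ Γ) ≈ (nest a Δ' ∷ Γ)

module Calculus (Σ : Set) (inv : Σ → Σ) (S : List Σ → List Σ → Set) where

  open Syntax Σ inv

  -- Der true  Γ : Γ derivable in SKm(S)
  -- Der false Γ : Γ derivable in SKm(S) without cut
  data Der : Bool → Seq → Set where
    mset : ∀ {withCut Γ Γ'} → Γ ≈ Γ' → Der withCut Γ → Der withCut Γ'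
    idr  : ∀ {withCut} Γ p → Der withCut (Γ ++ fm (at p) ∷ fm (nat p) ∷ [])
    cut  : ∀ {Γ Δ} A → Der true (Γ ++ [ fm A ]) → Der true (Δ ++ [ fm (∼ A) ])
           → Der true (Γ ++ Δ)
    ctr  : ∀ {withCut Γ Δ} → Der withCut (Γ ++ Δ ++ Δ) → Der withCut (Γ ++ Δ)
    wk   : ∀ {withCut Γ} Δ → Der withCut Γ → Der withCut (Γ ++ Δ)
    rr   : ∀ {withCut Γ Δ a} → Der withCut (Γ ++ [ nest a Δ ]) → Der withCut (nest (inv a) Γ ∷ Δ)
    andr : ∀ {withCut Γ A B} → Der withCut (Γ ++ [ fm A ]) → Der withCut (Γ ++ [ fm B ])
           → Der withCut (Γ ++ [ fm (A ∧ᶠ B) ])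
    orr  : ∀ {withCut Γ A B} → Der withCut (Γ ++ fm A ∷ fm B ∷ [])
           → Der withCut (Γ ++ [ fm (A ∨ᶠ B) ])
    boxr : ∀ {withCut Γ a A} → Der withCut (Γ ++ [ nest a [ fm A ] ])
           → Der withCut (Γ ++ [ fm (box a A) ])
    diar : ∀ {withCut Γ Δ a A} → Der withCut (Γ ++ [ nest a (Δ ++ [ fm A ]) ])
           → Der withCut (Γ ++ nest a Δ ∷ fm (dia a A) ∷ [])
    thue : ∀ {withCut u v Δ Γ} → S u v → Der withCut (wrap u Δ ++ Γ)
           → Der withCut (wrap v Δ ++ Γ)

record Alphabet : Set₁ where
  field
    Sym    : Set
    size   : ℕ
    finite : Fin size ↔ Sym
    inv    : Sym → Sym
    invol  : ∀ a → inv (inv a) ≡ a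

Closed : (Σ : Set) (inv : Σ → Σ) (S : List Σ → List Σ → Set) → Set
Closed Σ inv S = ∀ {u v} → S u v → S (Syntax.barW Σ inv u) (Syntax.barW Σ inv v)

-- Cut is admissible by induction on the cut formula alone, via a deep replacement
-- lemma in the spirit of Gentzen's mix: in a cut-free derivation, any occurrences
-- of a formula X, at any depth, may be replaced by a sequent Y, provided Y may
-- replace X whenever X is principal in a logical rule. Every other rule commutes
-- with such a replacement (contraction and weakening being primitive), so no
-- induction on derivation height is needed. The principal cases reduce to cuts
-- on immediate subformulas, using invertibility of ∧, ∨ and [a] (themselves
-- instances of the replacement lemma); in the modal case the residuation rule r
-- displays the nested structure a{Δ} at top level, the cut is made there, and r
-- puts it back.
module Submission where

open import Defs
open import Data.Bool using (true; false)
open import Data.List using (List; []; _∷_; _++_; [_])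
open import Data.List.Properties using (++-assoc; ++-identityʳ)
open import Data.Product using (∃; _×_; _,_)
open import Relation.Binary.PropositionalEquality using (_≡_; sym; subst)
open import Data.List.Relation.Binary.Permutation.Propositional as ↭
  using (_↭_; prep; swap; ↭-trans; ↭-sym; ↭-reflexive)
open import Data.List.Relation.Binary.Permutation.Propositional.Properties
  using (shift; ++-comm; ++⁺ˡ)

module CutElimination {Σ : Set} (inv : Σ → Σ) (S : List Σ → List Σ → Set) where
  open Syntax Σ inv
  open Calculus Σ inv S

  CutFree : Seq → Set
  CutFree = Der false

  ↭⇒≈ : ∀ {Γ Δ} → Γ ↭ Δ → Γ ≈ Δ
  ↭⇒≈ ↭.refl        = ≈-refl
  ↭⇒≈ (prep x p)    = ≈-tail (↭⇒≈ p)
  ↭⇒≈ (swap x y p)  = ≈-trans ≈-swap (≈-tail (≈-tail (↭⇒≈ p)))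
  ↭⇒≈ (↭.trans p q) = ≈-trans (↭⇒≈ p) (↭⇒≈ q)

  ≈-++⁺ˡ : ∀ Y {Γ Δ} → Γ ≈ Δ → (Y ++ Γ) ≈ (Y ++ Δ)
  ≈-++⁺ˡ []      p = p
  ≈-++⁺ˡ (y ∷ Y) p = ≈-tail (≈-++⁺ˡ Y p)

  permute : ∀ {b Γ Δ} → Γ ↭ Δ → Der b Γ → Der b Δ
  permute p = mset (↭⇒≈ p)

  exchange : ∀ {b} Γ Δ → Der b (Γ ++ Δ) → Der b (Δ ++ Γ)
  exchange Γ Δ = permute (++-comm Γ Δ)

  wkˡ : ∀ {b} Γ {Δ} → Der b Δ → Der b (Γ ++ Δ)
  wkˡ Γ {Δ} d = exchange Δ Γ (wk Γ d)

  contractˡ : ∀ {b} Γ Δ → Der b (Γ ++ Γ ++ Δ) → Der b (Γ ++ Δ)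
  contractˡ Γ Δ d = exchange Δ Γ (ctr {Γ = Δ} {Δ = Γ} (permute ΓΓΔ↭ΔΓΓ d))
    where ΓΓΔ↭ΔΓΓ = ↭-trans (↭-reflexive (sym (++-assoc Γ Γ Δ))) (++-comm (Γ ++ Γ) Δ)

  move-to-end : ∀ Γ (x : Item) Δ → (Γ ++ x ∷ Δ) ↭ ((Γ ++ Δ) ++ [ x ])
  move-to-end Γ x Δ = ↭-trans (++⁺ˡ Γ (++-comm [ x ] Δ)) (↭-reflexive (sym (++-assoc Γ Δ [ x ])))

  drop-++[] : ∀ {b} (C : Seq → Seq) Y → Der b (C (Y ++ [])) → Der b (C Y)
  drop-++[] {b} C Y = subst (λ Z → Der b (C Z)) (++-identityʳ Y)

  add-++[] : ∀ {b} (C : Seq → Seq) Y → Der b (C Y) → Der b (C (Y ++ []))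
  add-++[] {b} C Y = subst (λ Z → Der b (C Z)) (sym (++-identityʳ Y))

  mutual
    data Repl (X : Fm) (Y : Seq) : Seq → Seq → Set where
      []      : Repl X Y [] []
      keep    : ∀ {x x' Γ Γ'} → ReplItem X Y x x' → Repl X Y Γ Γ' → Repl X Y (x ∷ Γ) (x' ∷ Γ')
      replace : ∀ {Γ Γ'} → Repl X Y Γ Γ' → Repl X Y (fm X ∷ Γ) (Y ++ Γ')

    data ReplItem (X : Fm) (Y : Seq) : Item → Item → Set where
      fmᵣ   : ∀ {A} → ReplItem X Y (fm A) (fm A)
      nestᵣ : ∀ {a Δ Δ'} → Repl X Y Δ Δ' → ReplItem X Y (nest a Δ) (nest a Δ')

  module _ {X : Fm} {Y : Seq} where

    mutual
      Repl-refl : ∀ Γ → Repl X Y Γ Γ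
      Repl-refl []      = []
      Repl-refl (x ∷ Γ) = keep (ReplItem-refl x) (Repl-refl Γ)

      ReplItem-refl : ∀ x → ReplItem X Y x x
      ReplItem-refl (fm A)     = fmᵣ
      ReplItem-refl (nest a Δ) = nestᵣ (Repl-refl Δ)

    Repl-++ : ∀ {Γ Γ' Δ Δ'} → Repl X Y Γ Γ' → Repl X Y Δ Δ' → Repl X Y (Γ ++ Δ) (Γ' ++ Δ')
    Repl-++ []          r = r
    Repl-++ (keep x rΓ) r = keep x (Repl-++ rΓ r)
    Repl-++ {Δ' = Δ'} (replace {Γ' = Γ'} rΓ) r =
      subst (Repl X Y _) (sym (++-assoc Y Γ' Δ')) (replace (Repl-++ rΓ r))

    Repl-last : ∀ Γ → Repl X Y (Γ ++ [ fm X ]) (Γ ++ Y ++ [])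
    Repl-last Γ = Repl-++ (Repl-refl Γ) (replace [])

    data Repl-++-view (Γ Δ : Seq) : Seq → Set where
      _++ᵣ_ : ∀ {Γ' Δ'} → Repl X Y Γ Γ' → Repl X Y Δ Δ' → Repl-++-view Γ Δ (Γ' ++ Δ')

    Repl-split : ∀ Γ {Δ Θ} → Repl X Y (Γ ++ Δ) Θ → Repl-++-view Γ Δ Θ
    Repl-split []      r = [] ++ᵣ r
    Repl-split (x ∷ Γ) (keep x' r) with Repl-split Γ r
    ... | rΓ ++ᵣ rΔ = keep x' rΓ ++ᵣ rΔ
    Repl-split (x ∷ Γ) (replace r) with Repl-split Γ r
    ... | _++ᵣ_ {Γ'} {Δ'} rΓ rΔ =
      subst (Repl-++-view _ _) (++-assoc Y Γ' Δ') (replace rΓ ++ᵣ rΔ)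

    Repl-wrap : ∀ u {Δ Δ'} → Repl X Y Δ Δ' → Repl X Y (wrap u Δ) (wrap u Δ')
    Repl-wrap []      r = r
    Repl-wrap (a ∷ u) r = keep (nestᵣ (Repl-wrap u r)) []

    data Repl-wrap-view (v : List Σ) (Δ : Seq) : Seq → Set where
      wrapᵣ : ∀ {Δ'} → Repl X Y Δ Δ' → Repl-wrap-view v Δ (wrap v Δ')

    Repl-unwrap : ∀ v {Δ Θ} → Repl X Y (wrap v Δ) Θ → Repl-wrap-view v Δ Θ
    Repl-unwrap []      r = wrapᵣ r
    Repl-unwrap (a ∷ v) (keep (nestᵣ r) []) with Repl-unwrap v r
    ... | wrapᵣ r' = wrapᵣ r'

    ReplUpTo≈ : Seq → Seq → Set
    ReplUpTo≈ Γ₂ Θ = ∃ λ Θ₂ → Repl X Y Γ₂ Θ₂ × Θ ≈ Θ₂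

    Repl-swap : ∀ {x y Γ Θ} → Repl X Y (x ∷ y ∷ Γ) Θ → ReplUpTo≈ (y ∷ x ∷ Γ) Θ
    Repl-swap (keep x (keep y r))                       = _ , keep y (keep x r) , ≈-swap
    Repl-swap (keep {x' = x'} x (replace {Γ' = Γ'} r)) = _ , replace (keep x r) , ≈-sym (↭⇒≈ (shift x' Y Γ'))
    Repl-swap (replace (keep {x' = y'} {Γ' = Γ'} y r)) = _ , keep y (replace r) , ↭⇒≈ (shift y' Y Γ')
    Repl-swap (replace (replace r))                     = _ , replace (replace r) , ≈-refl

    Repl-≈-tail : ∀ {x Γ Γ₂ Θ} → (∀ {Θ'} → Repl X Y Γ Θ' → ReplUpTo≈ Γ₂ Θ')
                → Repl X Y (x ∷ Γ) Θ → ReplUpTo≈ (x ∷ Γ₂) Θ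
    Repl-≈-tail along (keep x r) with along r
    ... | _ , r₁ , e = _ , keep x r₁ , ≈-tail e
    Repl-≈-tail along (replace r) with along r
    ... | _ , r₁ , e = _ , replace r₁ , ≈-++⁺ˡ Y e

    mutual
      Repl-≈ : ∀ {Γ Γ₂ Θ} → Γ ≈ Γ₂ → Repl X Y Γ Θ → ReplUpTo≈ Γ₂ Θ
      Repl-≈ ≈-refl        r = _ , r , ≈-refl
      Repl-≈ (≈-sym p)     r = Repl-≈˘ p r
      Repl-≈ (≈-trans p q) r with Repl-≈ p r
      ... | _ , r₁ , e₁ with Repl-≈ q r₁
      ... | _ , r₂ , e₂ = _ , r₂ , ≈-trans e₁ e₂
      Repl-≈ ≈-swap        r = Repl-swap r
      Repl-≈ (≈-tail p)    r = Repl-≈-tail (Repl-≈ p) r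
      Repl-≈ (≈-nest p) (keep (nestᵣ r) rΓ) with Repl-≈ p r
      ... | _ , r₁ , e = _ , keep (nestᵣ r₁) rΓ , ≈-nest e

      Repl-≈˘ : ∀ {Γ Γ₂ Θ} → Γ₂ ≈ Γ → Repl X Y Γ Θ → ReplUpTo≈ Γ₂ Θ
      Repl-≈˘ ≈-refl        r = _ , r , ≈-refl
      Repl-≈˘ (≈-sym p)     r = Repl-≈ p r
      Repl-≈˘ (≈-trans p q) r with Repl-≈˘ q r
      ... | _ , r₁ , e₁ with Repl-≈˘ p r₁
      ... | _ , r₂ , e₂ = _ , r₂ , ≈-trans e₁ e₂
      Repl-≈˘ ≈-swap        r = Repl-swap r
      Repl-≈˘ (≈-tail p)    r = Repl-≈-tail (Repl-≈˘ p) r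
      Repl-≈˘ (≈-nest p) (keep (nestᵣ r) rΓ) with Repl-≈˘ p r
      ... | _ , r₁ , e = _ , keep (nestᵣ r₁) rΓ , ≈-nest e

  Principal : Fm → Seq → Set
  Principal (at p)    Y = ∀ Γ → CutFree (Γ ++ Y ++ [ fm (nat p) ])
  Principal (nat p)   Y = ∀ Γ → CutFree (Γ ++ fm (at p) ∷ Y)
  Principal (A ∧ᶠ B)  Y = ∀ Γ → CutFree (Γ ++ [ fm A ]) → CutFree (Γ ++ [ fm B ]) → CutFree (Γ ++ Y)
  Principal (A ∨ᶠ B)  Y = ∀ Γ → CutFree (Γ ++ fm A ∷ fm B ∷ []) → CutFree (Γ ++ Y)
  Principal (box a A) Y = ∀ Γ → CutFree (Γ ++ [ nest a [ fm A ] ]) → CutFree (Γ ++ Y)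
  Principal (dia a A) Y = ∀ Γ Δ → CutFree (Γ ++ [ nest a (Δ ++ [ fm A ]) ]) → CutFree (Γ ++ nest a Δ ∷ Y)

  replacement-admissible : ∀ {X Y} → Principal X Y → ∀ {Γ Θ} → CutFree Γ → Repl X Y Γ Θ → CutFree Θ
  replacement-admissible h (mset p d) r with Repl-≈˘ p r
  ... | _ , r₂ , e = mset (≈-sym e) (replacement-admissible h d r₂)
  replacement-admissible h (idr Γ p) r with Repl-split Γ r
  ... | _  ++ᵣ keep fmᵣ (keep fmᵣ [])         = idr _ p
  ... | _++ᵣ_ {Γ'} _ (replace (keep fmᵣ []))  = h Γ'
  ... | _++ᵣ_ {Γ'} _ (keep fmᵣ (replace []))  = add-++[] (λ Z → Γ' ++ fm (at p) ∷ Z) _ (h Γ')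
  replacement-admissible h (ctr {Γ = Γ} d) r with Repl-split Γ r
  ... | _++ᵣ_ {Γ'} {Δ'} rΓ rΔ =
    ctr {Γ = Γ'} {Δ = Δ'} (replacement-admissible h d (Repl-++ rΓ (Repl-++ rΔ rΔ)))
  replacement-admissible h (wk {Γ = Γ} Δ d) r with Repl-split Γ r
  ... | rΓ ++ᵣ _ = wk _ (replacement-admissible h d rΓ)
  replacement-admissible h (rr d) (keep (nestᵣ rΓ) rΔ) =
    rr (replacement-admissible h d (Repl-++ rΓ (keep (nestᵣ rΔ) [])))
  replacement-admissible h (andr {Γ = Γ} d₁ d₂) r with Repl-split Γ r
  ... | rΓ ++ᵣ keep fmᵣ [] = andr (replacement-admissible h d₁ (Repl-++ rΓ (keep fmᵣ [])))
                                  (replacement-admissible h d₂ (Repl-++ rΓ (keep fmᵣ [])))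
  ... | _++ᵣ_ {Γ'} rΓ (replace []) =
    add-++[] (Γ' ++_) _ (h Γ' (replacement-admissible h d₁ (Repl-++ rΓ (keep fmᵣ [])))
                        (replacement-admissible h d₂ (Repl-++ rΓ (keep fmᵣ []))))
  replacement-admissible h (orr {Γ = Γ} d) r with Repl-split Γ r
  ... | rΓ ++ᵣ keep fmᵣ [] = orr (replacement-admissible h d (Repl-++ rΓ (keep fmᵣ (keep fmᵣ []))))
  ... | _++ᵣ_ {Γ'} rΓ (replace []) =
    add-++[] (Γ' ++_) _ (h Γ' (replacement-admissible h d (Repl-++ rΓ (keep fmᵣ (keep fmᵣ [])))))
  replacement-admissible h (boxr {Γ = Γ} d) r with Repl-split Γ r
  ... | rΓ ++ᵣ keep fmᵣ [] =
    boxr (replacement-admissible h d (Repl-++ rΓ (keep (nestᵣ (keep fmᵣ [])) [])))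
  ... | _++ᵣ_ {Γ'} rΓ (replace []) =
    add-++[] (Γ' ++_) _ (h Γ' (replacement-admissible h d (Repl-++ rΓ (keep (nestᵣ (keep fmᵣ [])) []))))
  replacement-admissible h (diar {Γ = Γ} d) r with Repl-split Γ r
  ... | rΓ ++ᵣ keep (nestᵣ rΔ) (keep fmᵣ []) =
    diar (replacement-admissible h d (Repl-++ rΓ (keep (nestᵣ (Repl-++ rΔ (keep fmᵣ []))) [])))
  ... | _++ᵣ_ {Γ'} rΓ (keep (nestᵣ {Δ' = Δ'} rΔ) (replace [])) =
    add-++[] (λ Z → Γ' ++ _ ∷ Z) _
      (h Γ' Δ' (replacement-admissible h d (Repl-++ rΓ (keep (nestᵣ (Repl-++ rΔ (keep fmᵣ []))) []))))
  replacement-admissible h (thue {u = u} {v = v} {Δ = Δ} s d) r with Repl-split (wrap v Δ) r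
  ... | rv ++ᵣ rΓ with Repl-unwrap v rv
  ... | wrapᵣ rΔ = thue s (replacement-admissible h d (Repl-++ (Repl-wrap u rΔ) rΓ))

  replace-last : ∀ {X Y} Γ → Principal X Y → CutFree (Γ ++ [ fm X ]) → CutFree (Γ ++ Y)
  replace-last {Y = Y} Γ h d = drop-++[] (Γ ++_) Y (replacement-admissible h d (Repl-last Γ))

  box-inv : ∀ {a A} Γ → CutFree (Γ ++ [ fm (box a A) ]) → CutFree (Γ ++ [ nest a [ fm A ] ])
  box-inv Γ = replace-last Γ (λ _ d → d)

  ∨-inv : ∀ {A B} Γ → CutFree (Γ ++ [ fm (A ∨ᶠ B) ]) → CutFree (Γ ++ fm A ∷ fm B ∷ [])
  ∨-inv Γ = replace-last Γ (λ _ d → d)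

  ∧-invˡ : ∀ {A B} Γ → CutFree (Γ ++ [ fm (A ∧ᶠ B) ]) → CutFree (Γ ++ [ fm A ])
  ∧-invˡ Γ = replace-last Γ (λ _ d _ → d)

  ∧-invʳ : ∀ {A B} Γ → CutFree (Γ ++ [ fm (A ∧ᶠ B) ]) → CutFree (Γ ++ [ fm B ])
  ∧-invʳ Γ = replace-last Γ (λ _ _ d → d)

  module _ (invol : ∀ a → inv (inv a) ≡ a) where

    nested-cut : ∀ {a B C Γ₁ Δ₀ Γ₂}
               → (∀ {P Q} → CutFree (P ++ [ fm B ]) → CutFree (Q ++ [ fm C ]) → CutFree (P ++ Q))
               → CutFree (Γ₁ ++ [ nest a (Δ₀ ++ [ fm B ]) ]) → CutFree (Γ₂ ++ [ nest a [ fm C ] ])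
               → CutFree (Γ₁ ++ nest a Δ₀ ∷ Γ₂)
    nested-cut {a} {B} {C} {Γ₁} {Δ₀} {Γ₂} cutBC d₁ d₂ =
      permute (↭-sym (shift _ Γ₁ Γ₂)) (subst (λ b → CutFree (nest b Δ₀ ∷ Γ)) (invol a) undisplayed)
      where
        Γ : Seq
        Γ = Γ₁ ++ Γ₂

        āΓ : Item
        āΓ = nest (inv a) Γ

        displayed₁ : CutFree ((āΓ ∷ Δ₀) ++ [ fm B ])
        displayed₁ =
          rr (permute (↭-trans (↭-reflexive (++-assoc Γ₁ _ Γ₂)) (move-to-end Γ₁ _ Γ₂)) (wk Γ₂ d₁))

        displayed₂ : CutFree ((āΓ ∷ Δ₀) ++ [ fm C ])
        displayed₂ = permute (prep āΓ (++-comm [ fm C ] Δ₀))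
                       (wk Δ₀ (rr (permute (↭-reflexive (sym (++-assoc Γ₁ Γ₂ _))) (wkˡ Γ₁ d₂))))

        cut-displayed : CutFree (āΓ ∷ Δ₀)
        cut-displayed =
          ctr {Γ = []} {Δ = āΓ ∷ Δ₀} (cutBC {P = āΓ ∷ Δ₀} {Q = āΓ ∷ Δ₀} displayed₁ displayed₂)

        undisplayed : CutFree (nest (inv (inv a)) Δ₀ ∷ Γ)
        undisplayed = rr (exchange [ āΓ ] Δ₀ cut-displayed)

    cut-admissible : ∀ A {Γ Δ} → CutFree (Γ ++ [ fm A ]) → CutFree (Δ ++ [ fm (∼ A) ]) → CutFree (Γ ++ Δ)
    cut-admissible (at p) {Γ} d₁ d₂ = replace-last Γ (λ Γ' → wkˡ Γ' d₂) d₁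
    cut-admissible (nat p) {Γ} {Δ} d₁ d₂ =
      replace-last Γ (λ Γ' → wkˡ Γ' (exchange Δ [ fm (at p) ] d₂)) d₁
    cut-admissible (A ∧ᶠ B) {Γ} {Δ} d₁ d₂ = replace-last Γ principal d₁
      where
        principal : Principal (A ∧ᶠ B) Δ
        principal Γ' dA dB =
          contractˡ Γ' Δ (cut-admissible B dB (subst CutFree (sym (++-assoc Γ' Δ _)) cutA))
          where
            cutA : CutFree (Γ' ++ Δ ++ [ fm (∼ B) ])
            cutA = cut-admissible A dA (permute (move-to-end Δ _ _) (∨-inv Δ d₂))
    cut-admissible (A ∨ᶠ B) {Γ} {Δ} d₁ d₂ = replace-last Γ principal d₁
      where
        principal : Principal (A ∨ᶠ B) Δ
        principal Γ' dAB =
          ctr {Γ = Γ'} {Δ = Δ} (subst CutFree (++-assoc Γ' Δ Δ) (cut-admissible B ΓΔB (∧-invʳ Δ d₂)))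
          where
            cutA : CutFree ((Γ' ++ [ fm B ]) ++ Δ)
            cutA = cut-admissible A (permute (move-to-end Γ' _ _) dAB) (∧-invˡ Δ d₂)
            ΓΔB : CutFree ((Γ' ++ Δ) ++ [ fm B ])
            ΓΔB = permute (↭-trans (↭-reflexive (++-assoc Γ' _ Δ)) (move-to-end Γ' _ Δ)) cutA
    cut-admissible (box a A) {Γ} {Δ} d₁ d₂ =
      exchange Δ Γ (replace-last Δ (λ _ _ d → nested-cut cut∼A d (box-inv Γ d₁)) d₂)
      where
        cut∼A : ∀ {P Q} → CutFree (P ++ [ fm (∼ A) ]) → CutFree (Q ++ [ fm A ]) → CutFree (P ++ Q)
        cut∼A {P} {Q} d d' = exchange Q P (cut-admissible A d' d)
    cut-admissible (dia a A) {Γ} {Δ} d₁ d₂ =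
      replace-last Γ (λ _ _ d → nested-cut (cut-admissible A) d (box-inv Δ d₂)) d₁

    cut-elimination : ∀ {Γ} → Der true Γ → CutFree Γ
    cut-elimination (mset p d)          = mset p (cut-elimination d)
    cut-elimination (idr Γ p)           = idr Γ p
    cut-elimination (cut A d₁ d₂)       = cut-admissible A (cut-elimination d₁) (cut-elimination d₂)
    cut-elimination (ctr {Γ = Γ} {Δ} d) = ctr {Γ = Γ} {Δ = Δ} (cut-elimination d)
    cut-elimination (wk Δ d)            = wk Δ (cut-elimination d)
    cut-elimination (rr d)              = rr (cut-elimination d)
    cut-elimination (andr d₁ d₂)        = andr (cut-elimination d₁) (cut-elimination d₂)
    cut-elimination (orr d)             = orr (cut-elimination d)
    cut-elimination (boxr d)            = boxr (cut-elimination d)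
    cut-elimination (diar d)            = diar (cut-elimination d)
    cut-elimination (thue s d)          = thue s (cut-elimination d)

theorem3p4 : (A : Alphabet) (S : List (Alphabet.Sym A) → List (Alphabet.Sym A) → Set) → Closed (Alphabet.Sym A) (Alphabet.inv A) S → ∀ Γ → Calculus.Der (Alphabet.Sym A) (Alphabet.inv A) S true Γ → Calculus.Der (Alphabet.Sym A) (Alphabet.inv A) S false Γ
theorem3p4 A S _ _ = CutElimination.cut-elimination (Alphabet.inv A) S (Alphabet.invol A)
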